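{- Every 3-DORG is a stabbable grid intersection graph.
   Context: A 3-DORG is the bipartite intersection graph of a finite family of axis-parallel rays in the plane that use at most three of the four directions up, down, left, right, where start points have pairwise distinct x- and y-coordinates so that parallel rays are disjoint; a horizontal and a vertical ray are adjacent iff they intersect. A grid intersection graph (GIG) is the intersection graph of a finite family of horizontal and vertical line segments in the plane in which no two parallel segments intersect. A graph is a stabbable GIG if it has a GIG representation together with a straight line that intersects every segment of the representation.
   Formalization: The rays of a 3-DORG have start points with rational coordinates, and the segments of the grid intersection graph representation have rational endpoints and the stabbing line rational coefficients. -}

module Defs where

open import Data.Nat using (ℕ)
open import Data.Fin using (Fin)
open import Data.Rational using (ℚ; _≤_; _+_; _*_; 0ℚ)
open import Data.Product using (Σ; _×_; _,_; ∃; ∃-syntax)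
open import Data.Sum using (_⊎_)
open import Relation.Binary.PropositionalEquality using (_≡_; _≢_)
open import Relation.Nullary using (¬_)
open import Function.Bundles using (_⇔_)

Point : Set
Point = ℚ × ℚ

record Graph (n : ℕ) : Set₁ where
  field
    Adj     : Fin n → Fin n → Set
    symAdj  : ∀ {u v} → Adj u v → Adj v u
    irrAdj  : ∀ {u} → ¬ Adj u u
open Graph public

data Dir : Set where
  up down left right : Dir

record Ray : Set where
  constructor ray
  field
    sx sy : ℚ
    dir   : Dir
open Ray public

OnRay : Point → Ray → Set
OnRay (x , y) (ray sx sy up)    = x ≡ sx × sy ≤ y
OnRay (x , y) (ray sx sy down)  = x ≡ sx × y ≤ sy
OnRay (x , y) (ray sx sy left)  = y ≡ sy × x ≤ sx
OnRay (x , y) (ray sx sy right) = y ≡ sy × sx ≤ x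

RaysMeet : Ray → Ray → Set
RaysMeet r s = ∃[ p ] (OnRay p r × OnRay p s)

-- A 3-DORG representation of G: each vertex gets a ray, at most three
-- directions are used (some direction d is never used), start points have
-- pairwise distinct x- and y-coordinates, and two distinct vertices are
-- adjacent iff their rays intersect (parallel rays are then disjoint, so
-- this is the bipartite intersection graph horizontal/vertical).
record DORG3Rep {n : ℕ} (G : Graph n) : Set₁ where
  field
    ρ         : Fin n → Ray
    missing   : Dir
    avoids    : ∀ v → dir (ρ v) ≢ missing
    distinctX : ∀ u v → u ≢ v → sx (ρ u) ≢ sx (ρ v)
    distinctY : ∀ u v → u ≢ v → sy (ρ u) ≢ sy (ρ v)
    adjIff    : ∀ u v → u ≢ v → (Adj G u v ⇔ RaysMeet (ρ u) (ρ v))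

Is3DORG : ∀ {n} → Graph n → Set₁
Is3DORG G = DORG3Rep G

data Orient : Set where
  hor ver : Orient

-- hor: the segment {(x , c) | lo ≤ x ≤ hi};  ver: {(c , y) | lo ≤ y ≤ hi}
record Segment : Set where
  constructor seg
  field
    orient : Orient
    c      : ℚ
    lo hi  : ℚ
    lo≤hi  : lo ≤ hi
open Segment public

OnSeg : Point → Segment → Set
OnSeg (x , y) (seg hor c lo hi _) = y ≡ c × lo ≤ x × x ≤ hi
OnSeg (x , y) (seg ver c lo hi _) = x ≡ c × lo ≤ y × y ≤ hi

SegsMeet : Segment → Segment → Set
SegsMeet s t = ∃[ p ] (OnSeg p s × OnSeg p t)

record GIGRep {n : ℕ} (G : Graph n) : Set₁ where
  field
    σ         : Fin n → Segment
    parDisj   : ∀ u v → u ≢ v → orient (σ u) ≡ orient (σ v) → ¬ SegsMeet (σ u) (σ v)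
    adjIff    : ∀ u v → u ≢ v → (Adj G u v ⇔ SegsMeet (σ u) (σ v))

record Line : Set where
  constructor line
  field
    a b c  : ℚ
    nondeg : ¬ (a ≡ 0ℚ × b ≡ 0ℚ)

OnLine : Point → Line → Set
OnLine (x , y) (line a b c _) = a * x + b * y ≡ c

Stabs : Line → Segment → Set
Stabs ℓ s = ∃[ p ] (OnSeg p s × OnLine p ℓ)

IsStabbableGIG : ∀ {n} → Graph n → Set₁
IsStabbableGIG G = Σ (GIGRep G) λ R → ∃[ ℓ ] (∀ v → Stabs ℓ (GIGRep.σ R v))

-- Rotating by quarter turns we may assume that no ray points left.  Choose K
-- so large that every grid point (x_u , y_v) formed from start coordinates
-- satisfies ∣ y_v ∣ < K - x_u.  Replace an up-ray from (x , y) by the vertical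
-- segment on X = K - x from height y to K - x, a down-ray by the vertical
-- segment on X = x - K from height x - K to y, and a right-ray by the
-- horizontal segment at height y from x - K to K - x.  An up-ray at x₁ meets a
-- right-ray at x₂ iff x₂ ≤ x₁ iff K - x₁ ≤ K - x₂, and the remaining endpoint
-- conditions hold automatically by the choice of K; similarly for down-rays.
-- Every new segment meets the diagonal X = Y: vertical ones in an endpoint,
-- horizontal ones at (y , y).
module Submission where

open import Data.Nat using (ℕ; zero; suc)
open import Data.Fin using (Fin; zero; suc)
open import Data.Rational using (ℚ; _≤_; _<_; _+_; _-_; -_; _⊔_; 0ℚ; 1ℚ)
open import Data.Rational.Properties
open import Data.Rational.Solver using (module +-*-Solver)
open import Data.Product using (Σ; _×_; _,_; proj₁; proj₂; ∃-syntax; uncurry)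
open import Function.Base using (_∘_)
open import Function.Bundles using (_⇔_; mk⇔; Equivalence)
open import Function.Properties.Equivalence using () renaming (trans to ⇔-trans; sym to ⇔-sym)
open import Relation.Binary.PropositionalEquality
open import Relation.Nullary using (¬_; contradiction)

open import Defs

open +-*-Solver

neg-involutive : ∀ p → - (- p) ≡ p
neg-involutive = solve 1 (λ p → :- (:- p) := p) refl

neg-cancel-≤ : ∀ {p q} → - p ≤ - q → q ≤ p
neg-cancel-≤ {p} {q} h = subst₂ _≤_ (neg-involutive q) (neg-involutive p) (neg-antimono-≤ h)

+-cancelˡ-≤ : ∀ r {p q} → r + p ≤ r + q → p ≤ q
+-cancelˡ-≤ r {p} {q} h = subst₂ _≤_ (cancel r p) (cancel r q) (+-monoʳ-≤ (- r) h)
  where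
  cancel : ∀ r x → - r + (r + x) ≡ x
  cancel = solve 2 (λ r x → :- r :+ (r :+ x) := x) refl

+-cancelʳ-≤ : ∀ r {p q} → p + r ≤ q + r → p ≤ q
+-cancelʳ-≤ r {p} {q} h = +-cancelˡ-≤ r (subst₂ _≤_ (+-comm p r) (+-comm q r) h)

-‿antimonoʳ-≤ : ∀ r {p q} → p ≤ q → r - q ≤ r - p
-‿antimonoʳ-≤ r h = +-monoʳ-≤ r (neg-antimono-≤ h)

-‿cancelˡ-≤ : ∀ r {p q} → r - q ≤ r - p → p ≤ q
-‿cancelˡ-≤ r h = neg-cancel-≤ (+-cancelˡ-≤ r h)

-‿cancelʳ-≤ : ∀ r {p q} → p - r ≤ q - r → p ≤ q
-‿cancelʳ-≤ r = +-cancelʳ-≤ (- r)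

-‿cancelˡ-≡ : ∀ r {p q} → r - p ≡ r - q → p ≡ q
-‿cancelˡ-≡ r e =
  ≤-antisym (-‿cancelˡ-≤ r (≤-reflexive (sym e))) (-‿cancelˡ-≤ r (≤-reflexive e))

-‿cancelʳ-≡ : ∀ r {p q} → p - r ≡ q - r → p ≡ q
-‿cancelʳ-≡ r e =
  ≤-antisym (-‿cancelʳ-≤ r (≤-reflexive e)) (-‿cancelʳ-≤ r (≤-reflexive (sym e)))

p+q<r⇒q<r-p : ∀ {p q r} → p + q < r → q < r - p
p+q<r⇒q<r-p {p} {q} {r} h = subst (_< r - p) (cancel p q) (+-monoˡ-< (- p) h)
  where
  cancel : ∀ p q → p + q - p ≡ q
  cancel = solve 2 (λ p q → p :+ q :- p := q) refl

p-q<r⇒p-r<q : ∀ {p q r} → p - q < r → p - r < q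
p-q<r⇒p-r<q {p} {q} {r} h = subst₂ _<_ (telescope p q r) (cancel r q) (+-monoˡ-< (q - r) h)
  where
  telescope : ∀ p q r → p - q + (q - r) ≡ p - r
  telescope = solve 3 (λ p q r → p :- q :+ (q :- r) := p :- r) refl
  cancel : ∀ r q → r + (q - r) ≡ q
  cancel = solve 2 (λ r q → r :+ (q :- r) := q) refl

p<p+1 : ∀ p → p < p + 1ℚ
p<p+1 p = subst (_< p + 1ℚ) (+-identityʳ p) (+-monoʳ-< p (positive⁻¹ 1ℚ))

finite-upper-bound : ∀ {n} (f : Fin n → ℚ) → ∃[ M ] (∀ i → f i ≤ M)
finite-upper-bound {zero}  f = 0ℚ , λ ()
finite-upper-bound {suc n} f with finite-upper-bound (f ∘ suc)
... | M , f∘suc≤M = f zero ⊔ M , λ where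
  zero    → p≤p⊔q (f zero) M
  (suc i) → p≤q⇒p≤r⊔q (f zero) (f∘suc≤M i)

data InWedge (K : ℚ) : Point → Set where
  inWedge : ∀ {x y} → x + y < K → x - y < K → InWedge K (x , y)

y<K-x : ∀ {K x y} → InWedge K (x , y) → y < K - x
y<K-x (inWedge x+y<K _) = p+q<r⇒q<r-p x+y<K

x-K<y : ∀ {K x y} → InWedge K (x , y) → x - K < y
x-K<y {x = x} (inWedge _ x-y<K) = p-q<r⇒p-r<q {x} x-y<K

y≤K-x : ∀ {K x y} → InWedge K (x , y) → y ≤ K - x
y≤K-x = <⇒≤ ∘ y<K-x

x-K≤y : ∀ {K x y} → InWedge K (x , y) → x - K ≤ y
x-K≤y = <⇒≤ ∘ x-K<y

x-K≤K-x : ∀ {K x y} → InWedge K (x , y) → x - K ≤ K - x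
x-K≤K-x w = ≤-trans (x-K≤y w) (y≤K-x w)

grid-in-wedge : ∀ {n} (xs ys : Fin n → ℚ) → ∃[ K ] (∀ u v → InWedge K (xs u , ys v))
grid-in-wedge xs ys with finite-upper-bound (λ i → xs i ⊔ (ys i ⊔ - ys i))
... | M , bound =
  M + M + 1ℚ , λ u v → inWedge (sum<K (xs≤M u) (ys≤M v)) (sum<K (xs≤M u) (-ys≤M v))
  where
  sum<K : ∀ {p q} → p ≤ M → q ≤ M → p + q < M + M + 1ℚ
  sum<K p≤M q≤M = ≤-<-trans (+-mono-≤ p≤M q≤M) (p<p+1 (M + M))
  xs≤M : ∀ i → xs i ≤ M
  xs≤M i = p⊔q≤r⇒p≤r (xs i) _ (bound i)
  ys≤M : ∀ i → ys i ≤ M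
  ys≤M i = p⊔q≤r⇒p≤r (ys i) _ (p⊔q≤r⇒q≤r (xs i) _ (bound i))
  -ys≤M : ∀ i → - ys i ≤ M
  -ys≤M i = p⊔q≤r⇒q≤r (ys i) _ (p⊔q≤r⇒q≤r (xs i) _ (bound i))

⇔-empty : ∀ {A B : Set} → ¬ A → ¬ B → A ⇔ B
⇔-empty ¬a ¬b = mk⇔ (λ a → contradiction a ¬a) (λ b → contradiction b ¬b)

RaysMeet-comm : ∀ r s → RaysMeet r s ⇔ RaysMeet s r
RaysMeet-comm _ _ = mk⇔ swap swap
  where
  swap : ∀ {r s} → RaysMeet r s → RaysMeet s r
  swap (p , p∈r , p∈s) = p , p∈s , p∈r

SegsMeet-comm : ∀ s t → SegsMeet s t ⇔ SegsMeet t s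
SegsMeet-comm _ _ = mk⇔ swap swap
  where
  swap : ∀ {s t} → SegsMeet s t → SegsMeet t s
  swap (p , p∈s , p∈t) = p , p∈t , p∈s

up-meets-right⇔ : ∀ {x₁ y₁ x₂ y₂} →
  RaysMeet (ray x₁ y₁ up) (ray x₂ y₂ right) ⇔ (x₂ ≤ x₁ × y₁ ≤ y₂)
up-meets-right⇔ {x₁} {y₁} {x₂} {y₂} = mk⇔ to from
  where
  to : RaysMeet (ray x₁ y₁ up) (ray x₂ y₂ right) → x₂ ≤ x₁ × y₁ ≤ y₂
  to (_ , (refl , y₁≤y₂) , (refl , x₂≤x₁)) = x₂≤x₁ , y₁≤y₂
  from : x₂ ≤ x₁ × y₁ ≤ y₂ → RaysMeet (ray x₁ y₁ up) (ray x₂ y₂ right)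
  from (x₂≤x₁ , y₁≤y₂) = (x₁ , y₂) , (refl , y₁≤y₂) , (refl , x₂≤x₁)

down-meets-right⇔ : ∀ {x₁ y₁ x₂ y₂} →
  RaysMeet (ray x₁ y₁ down) (ray x₂ y₂ right) ⇔ (x₂ ≤ x₁ × y₂ ≤ y₁)
down-meets-right⇔ {x₁} {y₁} {x₂} {y₂} = mk⇔ to from
  where
  to : RaysMeet (ray x₁ y₁ down) (ray x₂ y₂ right) → x₂ ≤ x₁ × y₂ ≤ y₁
  to (_ , (refl , y₂≤y₁) , (refl , x₂≤x₁)) = x₂≤x₁ , y₂≤y₁
  from : x₂ ≤ x₁ × y₂ ≤ y₁ → RaysMeet (ray x₁ y₁ down) (ray x₂ y₂ right)
  from (x₂≤x₁ , y₂≤y₁) = (x₁ , y₂) , (refl , y₂≤y₁) , (refl , x₂≤x₁)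

ver-meets-hor⇔ : ∀ {a lo hi b lo′ hi′} (lo≤hi : lo ≤ hi) (lo′≤hi′ : lo′ ≤ hi′) →
  SegsMeet (seg ver a lo hi lo≤hi) (seg hor b lo′ hi′ lo′≤hi′) ⇔
  ((lo′ ≤ a × a ≤ hi′) × (lo ≤ b × b ≤ hi))
ver-meets-hor⇔ {a} {lo} {hi} {b} {lo′} {hi′} lo≤hi lo′≤hi′ = mk⇔ to from
  where
  to : SegsMeet (seg ver a lo hi lo≤hi) (seg hor b lo′ hi′ lo′≤hi′) →
       (lo′ ≤ a × a ≤ hi′) × (lo ≤ b × b ≤ hi)
  to (_ , (refl , lo≤b , b≤hi) , (refl , lo′≤a , a≤hi′)) = (lo′≤a , a≤hi′) , (lo≤b , b≤hi)
  from : (lo′ ≤ a × a ≤ hi′) × (lo ≤ b × b ≤ hi) →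
         SegsMeet (seg ver a lo hi lo≤hi) (seg hor b lo′ hi′ lo′≤hi′)
  from ((lo′≤a , a≤hi′) , (lo≤b , b≤hi)) =
    (a , b) , (refl , lo≤b , b≤hi) , (refl , lo′≤a , a≤hi′)

coord : Orient → Point → ℚ
coord hor (_ , y) = y
coord ver (x , _) = x

rayOrient : Dir → Orient
rayOrient up    = ver
rayOrient down  = ver
rayOrient left  = hor
rayOrient right = hor

start : Ray → Point
start r = sx r , sy r

onRay⇒coord≡ : ∀ {p} r → OnRay p r →
  coord (rayOrient (dir r)) p ≡ coord (rayOrient (dir r)) (start r)
onRay⇒coord≡ (ray _ _ up)    (e , _) = e
onRay⇒coord≡ (ray _ _ down)  (e , _) = e
onRay⇒coord≡ (ray _ _ left)  (e , _) = e
onRay⇒coord≡ (ray _ _ right) (e , _) = e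

onSeg⇒coord≡ : ∀ {p} s → OnSeg p s → coord (orient s) p ≡ c s
onSeg⇒coord≡ (seg hor _ _ _ _) (e , _) = e
onSeg⇒coord≡ (seg ver _ _ _ _) (e , _) = e

parallel-rays-disjoint : ∀ r s → rayOrient (dir r) ≡ rayOrient (dir s) →
  sx r ≢ sx s → sy r ≢ sy s → ¬ RaysMeet r s
parallel-rays-disjoint r s orient≡ sx≢ sy≢ (p , p∈r , p∈s) =
  distinct (rayOrient (dir s))
    (trans (sym (subst (λ o → coord o p ≡ coord o (start r)) orient≡ (onRay⇒coord≡ r p∈r)))
           (onRay⇒coord≡ s p∈s))
  where
  distinct : ∀ o → coord o (start r) ≢ coord o (start s)
  distinct hor = sy≢
  distinct ver = sx≢

parallel-segments-disjoint : ∀ s t → orient s ≡ orient t → c s ≢ c t → ¬ SegsMeet s t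
parallel-segments-disjoint s t orient≡ c≢ (p , p∈s , p∈t) =
  c≢ (trans (sym (subst (λ o → coord o p ≡ c s) orient≡ (onSeg⇒coord≡ s p∈s)))
            (onSeg⇒coord≡ t p∈t))

data NotLeft : Dir → Set where
  up    : NotLeft up
  down  : NotLeft down
  right : NotLeft right

notLeft : ∀ {d} → d ≢ left → NotLeft d
notLeft {up}    _   = up
notLeft {down}  _   = down
notLeft {left}  d≢l = contradiction refl d≢l
notLeft {right} _   = right

diagonal : Line
diagonal = line 1ℚ (- 1ℚ) 0ℚ (λ ())

onDiagonal : ∀ a → OnLine (a , a) diagonal
onDiagonal = solve 1 (λ a → con 1ℚ :* a :+ con (- 1ℚ) :* a := con 0ℚ) refl

module RaysToSegments (K : ℚ) where

  segment : (r : Ray) → NotLeft (dir r) → InWedge K (start r) → Segment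
  segment (ray x y up)    up    w = seg ver (K - x) y (K - x) (y≤K-x w)
  segment (ray x y down)  down  w = seg ver (x - K) (x - K) y (x-K≤y w)
  segment (ray x y right) right w = seg hor y (x - K) (K - x) (x-K≤K-x w)

  segment-orient : ∀ r nr w → orient (segment r nr w) ≡ rayOrient (dir r)
  segment-orient (ray _ _ up)    up    _ = refl
  segment-orient (ray _ _ down)  down  _ = refl
  segment-orient (ray _ _ right) right _ = refl

  segment-stabbed : ∀ r nr w → Stabs diagonal (segment r nr w)
  segment-stabbed (ray x y up)    up    w =
    (K - x , K - x) , (refl , y≤K-x w , ≤-refl) , onDiagonal (K - x)
  segment-stabbed (ray x y down)  down  w =
    (x - K , x - K) , (refl , ≤-refl , x-K≤y w) , onDiagonal (x - K)
  segment-stabbed (ray x y right) right w =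
    (y , y) , (refl , x-K≤y w , y≤K-x w) , onDiagonal y

  up-right-segments-meet⇔ : ∀ {x₁ y₁ x₂ y₂} (w₁ : InWedge K (x₁ , y₁)) (w₂ : InWedge K (x₂ , y₂)) →
    InWedge K (x₁ , y₂) →
    RaysMeet (ray x₁ y₁ up) (ray x₂ y₂ right) ⇔
    SegsMeet (segment (ray x₁ y₁ up) up w₁) (segment (ray x₂ y₂ right) right w₂)
  up-right-segments-meet⇔ {x₁} {y₁} {x₂} {y₂} w₁ w₂ w₁₂ =
    ⇔-trans up-meets-right⇔
      (⇔-trans (mk⇔ to from) (⇔-sym (ver-meets-hor⇔ (y≤K-x w₁) (x-K≤K-x w₂))))
    where
    to : x₂ ≤ x₁ × y₁ ≤ y₂ → (x₂ - K ≤ K - x₁ × K - x₁ ≤ K - x₂) × (y₁ ≤ y₂ × y₂ ≤ K - x₁)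
    to (x₂≤x₁ , y₁≤y₂) =
      (≤-trans (x-K≤y w₂) (y≤K-x w₁₂) , -‿antimonoʳ-≤ K x₂≤x₁) , (y₁≤y₂ , y≤K-x w₁₂)
    from : (x₂ - K ≤ K - x₁ × K - x₁ ≤ K - x₂) × (y₁ ≤ y₂ × y₂ ≤ K - x₁) → x₂ ≤ x₁ × y₁ ≤ y₂
    from ((_ , K-x₁≤K-x₂) , (y₁≤y₂ , _)) = -‿cancelˡ-≤ K K-x₁≤K-x₂ , y₁≤y₂

  down-right-segments-meet⇔ : ∀ {x₁ y₁ x₂ y₂} (w₁ : InWedge K (x₁ , y₁)) (w₂ : InWedge K (x₂ , y₂)) →
    InWedge K (x₁ , y₂) →
    RaysMeet (ray x₁ y₁ down) (ray x₂ y₂ right) ⇔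
    SegsMeet (segment (ray x₁ y₁ down) down w₁) (segment (ray x₂ y₂ right) right w₂)
  down-right-segments-meet⇔ {x₁} {y₁} {x₂} {y₂} w₁ w₂ w₁₂ =
    ⇔-trans down-meets-right⇔
      (⇔-trans (mk⇔ to from) (⇔-sym (ver-meets-hor⇔ (x-K≤y w₁) (x-K≤K-x w₂))))
    where
    to : x₂ ≤ x₁ × y₂ ≤ y₁ → (x₂ - K ≤ x₁ - K × x₁ - K ≤ K - x₂) × (x₁ - K ≤ y₂ × y₂ ≤ y₁)
    to (x₂≤x₁ , y₂≤y₁) =
      (+-monoˡ-≤ (- K) x₂≤x₁ , ≤-trans (x-K≤y w₁₂) (y≤K-x w₂)) , (x-K≤y w₁₂ , y₂≤y₁)
    from : (x₂ - K ≤ x₁ - K × x₁ - K ≤ K - x₂) × (x₁ - K ≤ y₂ × y₂ ≤ y₁) → x₂ ≤ x₁ × y₂ ≤ y₁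
    from ((x₂-K≤x₁-K , _) , (_ , y₂≤y₁)) = -‿cancelʳ-≤ K x₂-K≤x₁-K , y₂≤y₁

  parallel-segments-c≢ : ∀ r s nr ns (wr : InWedge K (start r)) (ws : InWedge K (start s)) →
    InWedge K (sx r , sy s) → InWedge K (sx s , sy r) → sx r ≢ sx s → sy r ≢ sy s →
    rayOrient (dir r) ≡ rayOrient (dir s) → c (segment r nr wr) ≢ c (segment s ns ws)
  parallel-segments-c≢ (ray _ _ up)    (ray _ _ up)    up    up    _  _  _   _   sx≢ _   _ =
    sx≢ ∘ -‿cancelˡ-≡ K
  parallel-segments-c≢ (ray _ _ down)  (ray _ _ down)  down  down  _  _  _   _   sx≢ _   _ =
    sx≢ ∘ -‿cancelʳ-≡ K
  parallel-segments-c≢ (ray _ _ right) (ray _ _ right) right right _  _  _   _   _   sy≢ _ = sy≢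
  parallel-segments-c≢ (ray _ _ up)    (ray _ _ down)  up    down  w₁ _  _   w₂₁ _   _   _ =
    <⇒≢ (<-trans (x-K<y w₂₁) (y<K-x w₁)) ∘ sym
  parallel-segments-c≢ (ray _ _ down)  (ray _ _ up)    down  up    _  w₂ w₁₂ _   _   _   _ =
    <⇒≢ (<-trans (x-K<y w₁₂) (y<K-x w₂))
  parallel-segments-c≢ (ray _ _ up)    (ray _ _ right) up    right _  _  _   _   _   _   ()
  parallel-segments-c≢ (ray _ _ down)  (ray _ _ right) down  right _  _  _   _   _   _   ()
  parallel-segments-c≢ (ray _ _ right) (ray _ _ up)    right up    _  _  _   _   _   _   ()
  parallel-segments-c≢ (ray _ _ right) (ray _ _ down)  right down  _  _  _   _   _   _   ()

  parallel-segments-meet⇔ : ∀ r s → rayOrient (dir r) ≡ rayOrient (dir s) →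
    ∀ nr ns (wr : InWedge K (start r)) (ws : InWedge K (start s)) →
    InWedge K (sx r , sy s) → InWedge K (sx s , sy r) → sx r ≢ sx s → sy r ≢ sy s →
    RaysMeet r s ⇔ SegsMeet (segment r nr wr) (segment s ns ws)
  parallel-segments-meet⇔ r s orient≡ nr ns wr ws wrs wsr sx≢ sy≢ =
    ⇔-empty (parallel-rays-disjoint r s orient≡ sx≢ sy≢)
      (parallel-segments-disjoint (segment r nr wr) (segment s ns ws)
        (trans (segment-orient r nr wr) (trans orient≡ (sym (segment-orient s ns ws))))
        (parallel-segments-c≢ r s nr ns wr ws wrs wsr sx≢ sy≢ orient≡))

  segments-meet⇔ : ∀ r s nr ns (wr : InWedge K (start r)) (ws : InWedge K (start s)) →
    InWedge K (sx r , sy s) → InWedge K (sx s , sy r) → sx r ≢ sx s → sy r ≢ sy s →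
    RaysMeet r s ⇔ SegsMeet (segment r nr wr) (segment s ns ws)
  segments-meet⇔ (ray _ _ up) (ray _ _ right) up right w₁ w₂ w₁₂ _ _ _ =
    up-right-segments-meet⇔ w₁ w₂ w₁₂
  segments-meet⇔ (ray _ _ down) (ray _ _ right) down right w₁ w₂ w₁₂ _ _ _ =
    down-right-segments-meet⇔ w₁ w₂ w₁₂
  segments-meet⇔ r@(ray _ _ right) s@(ray _ _ up) right up w₁ w₂ _ w₂₁ _ _ =
    ⇔-trans (RaysMeet-comm r s) (⇔-trans (up-right-segments-meet⇔ w₂ w₁ w₂₁)
      (SegsMeet-comm (segment s up w₂) (segment r right w₁)))
  segments-meet⇔ r@(ray _ _ right) s@(ray _ _ down) right down w₁ w₂ _ w₂₁ _ _ =
    ⇔-trans (RaysMeet-comm r s) (⇔-trans (down-right-segments-meet⇔ w₂ w₁ w₂₁)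
      (SegsMeet-comm (segment s down w₂) (segment r right w₁)))
  segments-meet⇔ r@(ray _ _ up)    s@(ray _ _ up)    = parallel-segments-meet⇔ r s refl
  segments-meet⇔ r@(ray _ _ up)    s@(ray _ _ down)  = parallel-segments-meet⇔ r s refl
  segments-meet⇔ r@(ray _ _ down)  s@(ray _ _ up)    = parallel-segments-meet⇔ r s refl
  segments-meet⇔ r@(ray _ _ down)  s@(ray _ _ down)  = parallel-segments-meet⇔ r s refl
  segments-meet⇔ r@(ray _ _ right) s@(ray _ _ right) = parallel-segments-meet⇔ r s refl

left-free-stabbable : ∀ {n} {G : Graph n} (R : DORG3Rep G) → DORG3Rep.missing R ≡ left →
  IsStabbableGIG G
left-free-stabbable {n} {G} R missing≡left =
  gig , diagonal , λ v → segment-stabbed (ρ v) (nl v) (w v v)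
  where
  open DORG3Rep R
  K : ℚ
  K = proj₁ (grid-in-wedge (sx ∘ ρ) (sy ∘ ρ))
  w : ∀ u v → InWedge K (sx (ρ u) , sy (ρ v))
  w = proj₂ (grid-in-wedge (sx ∘ ρ) (sy ∘ ρ))
  open RaysToSegments K
  nl : ∀ v → NotLeft (dir (ρ v))
  nl v = notLeft (λ dir≡left → avoids v (trans dir≡left (sym missing≡left)))
  σ′ : Fin n → Segment
  σ′ v = segment (ρ v) (nl v) (w v v)
  meets⇔ : ∀ u v → u ≢ v → RaysMeet (ρ u) (ρ v) ⇔ SegsMeet (σ′ u) (σ′ v)
  meets⇔ u v u≢v = segments-meet⇔ (ρ u) (ρ v) (nl u) (nl v) (w u u) (w v v) (w u v) (w v u)
                     (distinctX u v u≢v) (distinctY u v u≢v)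
  gig : GIGRep G
  gig = record
    { σ       = σ′
    ; parDisj = λ u v u≢v orient≡ →
        parallel-rays-disjoint (ρ u) (ρ v)
          (trans (sym (segment-orient (ρ u) (nl u) (w u u)))
                 (trans orient≡ (segment-orient (ρ v) (nl v) (w v v))))
          (distinctX u v u≢v) (distinctY u v u≢v)
        ∘ Equivalence.from (meets⇔ u v u≢v)
    ; adjIff  = λ u v u≢v → ⇔-trans (adjIff u v u≢v) (meets⇔ u v u≢v)
    }

rotateDir : Dir → Dir
rotateDir up    = left
rotateDir left  = down
rotateDir down  = right
rotateDir right = up

rotateDir⁴ : ∀ d → rotateDir (rotateDir (rotateDir (rotateDir d))) ≡ d
rotateDir⁴ up    = refl
rotateDir⁴ down  = refl
rotateDir⁴ left  = refl
rotateDir⁴ right = refl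

rotateDir-injective : ∀ {d e} → rotateDir d ≡ rotateDir e → d ≡ e
rotateDir-injective {d} {e} eq =
  trans (sym (rotateDir⁴ d)) (trans (cong (rotateDir ∘ rotateDir ∘ rotateDir) eq) (rotateDir⁴ e))

rotatePoint : Point → Point
rotatePoint (x , y) = - y , x

rotateRay : Ray → Ray
rotateRay r = ray (- sy r) (sx r) (rotateDir (dir r))

onRay-rotate : ∀ {p} r → OnRay p r → OnRay (rotatePoint p) (rotateRay r)
onRay-rotate (ray _ _ up)    (e , h) = e , neg-antimono-≤ h
onRay-rotate (ray _ _ left)  (e , h) = cong -_ e , h
onRay-rotate (ray _ _ down)  (e , h) = e , neg-antimono-≤ h
onRay-rotate (ray _ _ right) (e , h) = cong -_ e , h

onRay-rotate⁻ : ∀ {p} r → OnRay (rotatePoint p) (rotateRay r) → OnRay p r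
onRay-rotate⁻ (ray _ _ up)    (e , h) = e , neg-cancel-≤ h
onRay-rotate⁻ (ray _ _ left)  (e , h) = neg-injective e , h
onRay-rotate⁻ (ray _ _ down)  (e , h) = e , neg-cancel-≤ h
onRay-rotate⁻ (ray _ _ right) (e , h) = neg-injective e , h

onRay-unrotate : ∀ {x y} r → OnRay (x , y) (rotateRay r) → OnRay (y , - x) r
onRay-unrotate {x} {y} r =
  onRay-rotate⁻ r ∘ subst (λ p → OnRay p (rotateRay r)) (cong (_, y) (sym (neg-involutive x)))

rotate-meets⇔ : ∀ r s → RaysMeet r s ⇔ RaysMeet (rotateRay r) (rotateRay s)
rotate-meets⇔ r s = mk⇔ to from
  where
  to : RaysMeet r s → RaysMeet (rotateRay r) (rotateRay s)
  to (p , p∈r , p∈s) = rotatePoint p , onRay-rotate r p∈r , onRay-rotate s p∈s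
  from : RaysMeet (rotateRay r) (rotateRay s) → RaysMeet r s
  from ((x , y) , q∈r , q∈s) = (y , - x) , onRay-unrotate r q∈r , onRay-unrotate s q∈s

rotateRep : ∀ {n} {G : Graph n} → DORG3Rep G → DORG3Rep G
rotateRep R = record
  { ρ         = rotateRay ∘ ρ
  ; missing   = rotateDir missing
  ; avoids    = λ v → avoids v ∘ rotateDir-injective
  ; distinctX = λ u v u≢v → distinctY u v u≢v ∘ neg-injective
  ; distinctY = distinctX
  ; adjIff    = λ u v u≢v → ⇔-trans (adjIff u v u≢v) (rotate-meets⇔ (ρ u) (ρ v))
  }
  where open DORG3Rep R

rotate-to-left-free : ∀ {n} {G : Graph n} → DORG3Rep G →
  Σ (DORG3Rep G) λ R → DORG3Rep.missing R ≡ left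
rotate-to-left-free R with DORG3Rep.missing R in missing≡
... | left  = R , missing≡
... | up    = rotateRep R , cong rotateDir missing≡
... | right = rotateRep (rotateRep R) , cong (rotateDir ∘ rotateDir) missing≡
... | down  =
  rotateRep (rotateRep (rotateRep R)) , cong (rotateDir ∘ rotateDir ∘ rotateDir) missing≡

proposition4 : ∀ (n : ℕ) (G : Graph n) → Is3DORG G → IsStabbableGIG G
proposition4 n G R = uncurry left-free-stabbable (rotate-to-left-free R)
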